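{- The system $\mathbb{SKYR}$ is sound with respect to the class of all $\mathcal{S}5$-$\mathbf{ELKy^r}$-models: for every set $\Gamma\subseteq\mathcal{L}_{ELKy^r}$ and every $\phi\in\mathcal{L}_{ELKy^r}$, if $\Gamma\vdash_{\mathbb{SKYR}}\phi$ then $\Gamma\models\phi$ (for every model $\mathfrak{M}$ in the class and world $w$, if all formulas of $\Gamma$ hold at $(\mathfrak{M},w)$ then $\phi$ holds at $(\mathfrak{M},w)$).
   Context: Fix a countable set of agents $\mathcal{A}$ and a countably infinite set of atoms $\mathcal{P}$. $\mathcal{L}_{ELKy^r}$: $\phi ::= p\mid\neg\phi\mid(\phi\land\phi)\mid K_a\phi\mid Ky_a^r(\phi,\phi)$; $\to,\top,\bot$ as usual. $\Lambda\subseteq\mathcal{L}_{ELKy^r}$ is a fixed set of formulas valid in the class below (tautology ground). An $\mathcal{S}5$-$\mathbf{ELKy^r}$-model is $\mathfrak{M}=\langle W,E,\{R_a\}_{a\in\mathcal{A}},\mathcal{E},V\rangle$ with $W\neq\emptyset$; $E$ nonempty, containing a designated $e$, closed under a binary operation $\cdot$; each $R_a$ an equivalence relation on $W$; $\mathcal{E}:E\times\mathcal{L}_{ELKy^r}\to 2^W$ with $\mathcal{E}(e,\phi)=W$ for $\phi\in\Lambda$ and $\mathcal{E}(s,\phi\to\psi)\cap\mathcal{E}(t,\phi)\subseteq\mathcal{E}(s\cdot t,\psi)$; $V:\mathcal{P}\to 2^W$. Truth: $p,\neg,\land$ as usual; $K_a\phi$ holds at $w$ iff $\phi$ holds at all $R_a$-successors;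 $Ky_a^r(\phi,\psi)$ holds at $w$ iff there is $t\in E$ such that every $v$ with $(w,v)\in R_a$ and $(\mathfrak{M},v)\models\phi$ satisfies $v\in\mathcal{E}(t,\psi)$ and $(\mathfrak{M},v)\models\psi$. $\mathbb{SKYR}$ has, for all agents and formulas: (PT) propositional tautologies; (K) $K_a(\phi\to\psi)\to(K_a\phi\to K_a\psi)$; (T) $K_a\phi\to\phi$; (4) $K_a\phi\to K_aK_a\phi$; (5) $\neg K_a\phi\to K_a\neg K_a\phi$; (EKyR) $Ky_a^r(\chi,\phi\to\psi)\to(Ky_a^r(\theta,\phi)\to Ky_a^r(\chi\land\theta,\psi))$; (4YKR) $Ky_a^r(\phi,\psi)\to K_aKy_a^r(\phi,\psi)$; (DKyR) $Ky_a^r(\phi,\psi)\to K_a(\phi\to\psi)$; (IKyR) $Ky_a^r(\psi,\chi)\to(K_a(\phi\to\psi)\to Ky_a^r(\phi,\chi))$; (UKyR) $K_a\neg\phi\to Ky_a^r(\phi,\psi)$; rules (MP); (NK) from $\vdash\phi$ infer $\vdash K_a\phi$; (NKyR) from $\phi\in\Lambda$ infer $\vdash Ky_a^r(\top,\phi)$. $\Gamma\vdash\phi$ means $\phi$ follows from $\Gamma$ and theorems of $\mathbb{SKYR}$ by (MP) (the necessitation rules apply only to theorems). -}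

module Defs where

open import Data.Nat using (ℕ)
open import Data.Bool using (Bool; true; false; not; _∧_)
open import Data.Product using (Σ; _×_; _,_)
open import Relation.Nullary using (¬_)
open import Relation.Binary.PropositionalEquality using (_≡_)
open import Relation.Binary.Structures using (IsEquivalence)
open import Level using (Level) renaming (suc to lsuc; zero to lzero)

-- Atoms: ℕ (countably infinite).  Agents: an arbitrary type Ag
-- (countability is a hypothesis of the theorem).
Atom : Set
Atom = ℕ

data Form (Ag : Set) : Set where
  atom : Atom → Form Ag
  ¬'_  : Form Ag → Form Ag
  _∧'_ : Form Ag → Form Ag → Form Ag
  K    : Ag → Form Ag → Form Ag
  Kyr  : Ag → Form Ag → Form Ag → Form Ag

infixr 6 _∧'_
module _ {Ag : Set} where
  infixr 5 _⇒_
  _⇒_ : Form Ag → Form Ag → Form Ag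
  φ ⇒ ψ = ¬' (φ ∧' ¬' ψ)

  ⊥' : Form Ag
  ⊥' = atom 0 ∧' ¬' atom 0

  ⊤' : Form Ag
  ⊤' = ¬' ⊥'

  -- Propositional tautologies: formulas true under every Boolean
  -- valuation of their maximal non-propositional subformulas
  -- (atoms, K_a φ and Ky^r_a(φ,ψ) are treated as propositional letters).
  evalB : (Form Ag → Bool) → Form Ag → Bool
  evalB ρ (atom p)    = ρ (atom p)
  evalB ρ (¬' φ)      = not (evalB ρ φ)
  evalB ρ (φ ∧' ψ)    = evalB ρ φ ∧ evalB ρ ψ
  evalB ρ (K a φ)     = ρ (K a φ)
  evalB ρ (Kyr a φ ψ) = ρ (Kyr a φ ψ)

  Tautology : Form Ag → Set
  Tautology φ = ∀ (ρ : Form Ag → Bool) → evalB ρ φ ≡ true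

record Model (Ag : Set) (Λ : Form Ag → Set) : Set₁ where
  field
    W     : Set
    inhW  : W
    E     : Set
    e     : E
    _·_   : E → E → E
    R     : Ag → W → W → Set
    R-equiv : ∀ a → IsEquivalence (R a)
    ℰ     : E → Form Ag → W → Set      -- ℰ(t,φ) ⊆ W as a predicate
    ℰ-Λ   : ∀ φ → Λ φ → ∀ w → ℰ e φ w
    ℰ-app : ∀ s t φ ψ w → ℰ s (φ ⇒ ψ) w → ℰ t φ w → ℰ (s · t) ψ w
    V     : Atom → W → Set

module _ {Ag : Set} {Λ : Form Ag → Set} where
  open Model

  Sat : (M : Model Ag Λ) → W M → Form Ag → Set
  Sat M w (atom p   ) = V M p w
  Sat M w (¬' φ     ) = ¬ (Sat M w φ)
  Sat M w ((φ ∧' ψ) ) = (Sat M w φ) × (Sat M w ψ)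
  Sat M w (K a φ    ) = ∀ v → R M a w v → Sat M v φ
  Sat M w (Kyr a φ ψ) = Σ (E M) λ t →
    ∀ v → R M a w v → Sat M v (φ) → ℰ M t ψ v × (Sat M v ψ)

  Valid : Form Ag → Set₁
  Valid φ = ∀ (M : Model Ag Λ) (w : W M) → Sat M w φ

  _⊨_ : (Form Ag → Set) → Form Ag → Set₁
  Γ ⊨ φ = ∀ (M : Model Ag Λ) (w : W M) →
            (∀ ψ → Γ ψ → Sat M w (ψ)) → Sat M w φ

data Thm {Ag : Set} (Λ : Form Ag → Set) : Form Ag → Set where
  PT   : ∀ {φ} → Tautology φ → Thm Λ φ
  Kax  : ∀ {a φ ψ} → Thm Λ (K a (φ ⇒ ψ) ⇒ (K a φ ⇒ K a ψ))
  Tax  : ∀ {a φ} → Thm Λ (K a φ ⇒ φ)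
  4ax  : ∀ {a φ} → Thm Λ (K a φ ⇒ K a (K a φ))
  5ax  : ∀ {a φ} → Thm Λ (¬' K a φ ⇒ K a (¬' K a φ))
  EKyR : ∀ {a χ θ φ ψ} →
         Thm Λ (Kyr a χ (φ ⇒ ψ) ⇒ (Kyr a θ φ ⇒ Kyr a (χ ∧' θ) ψ))
  4YKR : ∀ {a φ ψ} → Thm Λ (Kyr a φ ψ ⇒ K a (Kyr a φ ψ))
  DKyR : ∀ {a φ ψ} → Thm Λ (Kyr a φ ψ ⇒ K a (φ ⇒ ψ))
  IKyR : ∀ {a φ ψ χ} →
         Thm Λ (Kyr a ψ χ ⇒ (K a (φ ⇒ ψ) ⇒ Kyr a φ χ))
  UKyR : ∀ {a φ ψ} → Thm Λ (K a (¬' φ) ⇒ Kyr a φ ψ)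
  MP   : ∀ {φ ψ} → Thm Λ (φ ⇒ ψ) → Thm Λ φ → Thm Λ ψ
  NK   : ∀ {a φ} → Thm Λ φ → Thm Λ (K a φ)
  NKyR : ∀ {a φ} → Λ φ → Thm Λ (Kyr a ⊤' φ)

-- Derivability from premises: Γ ⊢ φ (necessitation only on theorems)
data Derives {Ag : Set} (Λ : Form Ag → Set) (Γ : Form Ag → Set)
     : Form Ag → Set where
  hyp : ∀ {φ} → Γ φ → Derives Λ Γ φ
  thm : ∀ {φ} → Thm Λ φ → Derives Λ Γ φ
  mp  : ∀ {φ ψ} → Derives Λ Γ (φ ⇒ ψ) → Derives Λ Γ φ → Derives Λ Γ ψ

module Submission where

-- Everything is proved pointwise in M, by induction on
-- derivations, with two auxiliary facts about the defined connective
-- φ ⇒ ψ = ¬(φ ∧ ¬ψ):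
--   * introduction is constructive, while modus ponens at a world needs
--     excluded middle (to remove the double negation of the consequent);
--   * the classical valuation "χ is true at w", decided by excluded
--     middle, reflects truth of every formula through evalB, so every
--     propositional tautology holds at every world.
-- Each remaining axiom is valid by the equivalence-relation properties
-- of R a (K, T, 4, 5, 4YKR), by the closure of ℰ under · (EKyR), by the
-- designated witness e (UKyR, NKyR, using validity of Λ), or directly
-- from the truth clause of Ky^r (DKyR, IKyR).

open import Defs
open import Data.Nat using (ℕ)
open import Data.Product using (Σ)
open import Function.Definitions using (Injective)
open import Relation.Binary.PropositionalEquality using (_≡_)
open import Axiom.ExcludedMiddle using (ExcludedMiddle)
open import Level using (0ℓ)

open import Data.Bool using (Bool)
open import Data.Product using (_,_; proj₁; proj₂)
open import Data.Empty using (⊥-elim)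
open import Relation.Nullary using (does; proof)
open import Relation.Nullary.Decidable using (decidable-stable)
open import Relation.Nullary.Reflects using (Reflects; invert; ¬-reflects; _×-reflects_)
open import Relation.Binary.PropositionalEquality using (subst)
open import Relation.Binary.Structures using (IsEquivalence)

module Soundness (em : ExcludedMiddle 0ℓ) {Ag : Set} {Λ : Form Ag → Set}
                 (M : Model Ag Λ) where
  open Model M

  infix 4 _⊩_
  _⊩_ : W → Form Ag → Set
  w ⊩ φ = Sat M w φ

  module Acc (a : Ag) = IsEquivalence (R-equiv a)

  ⇒-intro : ∀ {w} φ ψ → (w ⊩ φ → w ⊩ ψ) → w ⊩ φ ⇒ ψ
  ⇒-intro φ ψ f (sφ , ¬sψ) = ¬sψ (f sφ)

  ⇒-elim : ∀ {w} φ ψ → w ⊩ φ ⇒ ψ → w ⊩ φ → w ⊩ ψ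
  ⇒-elim φ ψ h sφ = decidable-stable em (λ ¬sψ → h (sφ , ¬sψ))

  valuation : W → Form Ag → Bool
  valuation w χ = does (em {w ⊩ χ})

  evalB-reflects : ∀ w χ → Reflects (w ⊩ χ) (evalB (valuation w) χ)
  evalB-reflects w (atom p)    = proof em
  evalB-reflects w (K a φ)     = proof em
  evalB-reflects w (Kyr a φ ψ) = proof em
  evalB-reflects w (¬' φ)      = ¬-reflects (evalB-reflects w φ)
  evalB-reflects w (φ ∧' ψ)    = evalB-reflects w φ ×-reflects evalB-reflects w ψ

  tautology-holds : ∀ {φ} → Tautology φ → ∀ w → w ⊩ φ
  tautology-holds {φ} taut w =
    invert (subst (Reflects (w ⊩ φ)) (taut (valuation w)) (evalB-reflects w φ))

  theorem-holds : (∀ φ → Λ φ → Valid {Ag} {Λ} φ) → ∀ {φ} → Thm Λ φ → ∀ w → w ⊩ φ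
  theorem-holds ΛV (PT {φ} taut) w = tautology-holds {φ} taut w
  theorem-holds ΛV (Kax {a} {φ} {ψ}) w =
    ⇒-intro (K a (φ ⇒ ψ)) (K a φ ⇒ K a ψ) λ kφ⇒ψ →
    ⇒-intro (K a φ) (K a ψ) λ kφ v r → ⇒-elim φ ψ (kφ⇒ψ v r) (kφ v r)
  theorem-holds ΛV (Tax {a} {φ}) w =
    ⇒-intro (K a φ) φ λ kφ → kφ w (Acc.refl a)
  theorem-holds ΛV (4ax {a} {φ}) w =
    ⇒-intro (K a φ) (K a (K a φ)) λ kφ v r u r′ → kφ u (Acc.trans a r r′)
  theorem-holds ΛV (5ax {a} {φ}) w =
    ⇒-intro (¬' K a φ) (K a (¬' K a φ)) λ ¬kφ v r kφ →
      ¬kφ λ u r′ → kφ u (Acc.trans a (Acc.sym a r) r′)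
  -- Evidence composes: t₁ for φ ⇒ ψ and t₂ for φ give t₁ · t₂ for ψ.
  theorem-holds ΛV (EKyR {a} {χ} {θ} {φ} {ψ}) w =
    ⇒-intro (Kyr a χ (φ ⇒ ψ)) (Kyr a θ φ ⇒ Kyr a (χ ∧' θ) ψ) λ (t₁ , h₁) →
    ⇒-intro (Kyr a θ φ) (Kyr a (χ ∧' θ) ψ) λ (t₂ , h₂) →
      t₁ · t₂ , λ v r (sχ , sθ) →
        let (ℰ₁ , s₁) = h₁ v r sχ ; (ℰ₂ , s₂) = h₂ v r sθ
        in ℰ-app t₁ t₂ φ ψ v ℰ₁ ℰ₂ , ⇒-elim φ ψ s₁ s₂
  theorem-holds ΛV (4YKR {a} {φ} {ψ}) w =
    ⇒-intro (Kyr a φ ψ) (K a (Kyr a φ ψ)) λ (t , h) v r →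
      t , λ u r′ → h u (Acc.trans a r r′)
  theorem-holds ΛV (DKyR {a} {φ} {ψ}) w =
    ⇒-intro (Kyr a φ ψ) (K a (φ ⇒ ψ)) λ (t , h) v r →
      ⇒-intro φ ψ λ sφ → proj₂ (h v r sφ)
  theorem-holds ΛV (IKyR {a} {φ} {ψ} {χ}) w =
    ⇒-intro (Kyr a ψ χ) (K a (φ ⇒ ψ) ⇒ Kyr a φ χ) λ (t , h) →
    ⇒-intro (K a (φ ⇒ ψ)) (Kyr a φ χ) λ kφ⇒ψ →
      t , λ v r sφ → h v r (⇒-elim φ ψ (kφ⇒ψ v r) sφ)
  -- If φ holds at no accessible world, any evidence term works vacuously.
  theorem-holds ΛV (UKyR {a} {φ} {ψ}) w =
    ⇒-intro (K a (¬' φ)) (Kyr a φ ψ) λ k¬φ → e , λ v r sφ → ⊥-elim (k¬φ v r sφ)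
  theorem-holds ΛV (MP {φ} {ψ} d₁ d₂) w =
    ⇒-elim φ ψ (theorem-holds ΛV d₁ w) (theorem-holds ΛV d₂ w)
  theorem-holds ΛV (NK d) w v r = theorem-holds ΛV d v
  -- Members of Λ are witnessed by e everywhere and are valid by assumption.
  theorem-holds ΛV (NKyR {a} {φ} λφ) w = e , λ v r _ → ℰ-Λ φ λφ v , ΛV φ λφ M v

  derivable-holds : (∀ φ → Λ φ → Valid {Ag} {Λ} φ) →
    ∀ {Γ φ} w → (∀ ψ → Γ ψ → w ⊩ ψ) → Derives Λ Γ φ → w ⊩ φ
  derivable-holds ΛV w sΓ (hyp γ)  = sΓ _ γ
  derivable-holds ΛV w sΓ (thm d)  = theorem-holds ΛV d w
  derivable-holds ΛV w sΓ (mp {φ} {ψ} d₁ d₂) =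
    ⇒-elim φ ψ (derivable-holds ΛV w sΓ d₁) (derivable-holds ΛV w sΓ d₂)

theorem3p10 : ExcludedMiddle 0ℓ →
    (Ag : Set) → Σ (Ag → ℕ) (Injective _≡_ _≡_) →
    (Λ : Form Ag → Set) → (∀ φ → Λ φ → Valid {Ag} {Λ} φ) →
    (Γ : Form Ag → Set) (φ : Form Ag) →
    Derives Λ Γ φ → _⊨_ {Ag} {Λ} Γ φ
theorem3p10 em Ag _ Λ ΛV Γ φ d M w sΓ = Soundness.derivable-holds em M ΛV w sΓ d
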